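{- Let $f\in V_1$. Then $s_{0,0}(f)=w^{ -9}f(w^{10})$, $s_{1,0}(f)=w^{ -7}f(w^{10})$, $s_{0,1}(f)=w^{ -3}f(w^{10})$, and $s_{2,0}(f)=w^{ -1}f(w^{10})$.
   Context: Let $g:\mathbb{N}\to\mathbb{N}$ be given by $g(0)=0$, $g(2n)=4g(n)$, $g(2n+1)=g(2n)+1$, and $[a,b]=t^{1+2g(a)+4g(b)}$ for $a,b\in\mathbb{N}$. Let $V=t\,\mathbb{Z}/2[t^2]$, $V'\subset\mathbb{Z}/2[w]$ spanned by the $w^k$ with $k\equiv1,3,7,9\pmod{20}$, and $\varphi:V\to V'$ the $\mathbb{Z}/2$-linear map with $\varphi(t),\varphi(t^3),\varphi(t^5),\varphi(t^9)=w,w^3,w^7,w^9$; $\varphi(t^7),\varphi(t^{11}),\varphi(t^{13}),\varphi(t^{15})=w^{21},w^{27},w^{23},w^{29}$; $\varphi(t^{16}f)=w^{40}\varphi(f)$. Put $\langle a,b\rangle=\varphi([a,b])$. $V_1\subset V$ is the span of the $t^n$ with $n\equiv1\pmod4$. For $i,j\ge0$, $s_{i,j}:V\to V'$ is the $\mathbb{Z}/2$-linear map with $s_{i,j}([c,d])=\langle 2c+i,2d+j\rangle$. -}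

module Defs where

open import Data.Nat using (ℕ; zero; suc; _+_; _*_; _∸_; _≡ᵇ_)
open import Data.Nat.DivMod using (_/_; _%_)
open import Data.Bool using (Bool; true; false; not; if_then_else_)
open import Data.List using (List; []; _∷_; map)
open import Data.Product using (_×_; _,_)
open import Relation.Binary.PropositionalEquality using (_≡_)

-- Polynomials over ℤ/2 in one variable (t or w), represented by a list
-- of exponents: the list [n₁, …, nₖ] stands for t^n₁ + … + t^nₖ
-- (computed in ℤ/2, so repeated monomials cancel in pairs).

Poly : Set
Poly = List ℕ

coeff : Poly → ℕ → Bool
coeff []       k = false
coeff (x ∷ xs) k = if x ≡ᵇ k then not (coeff xs k) else coeff xs k

infix 4 _≈_
_≈_ : Poly → Poly → Set
p ≈ q = ∀ k → coeff p k ≡ coeff q k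

-- g(0)=0, g(2n)=4g(n), g(2n+1)=g(2n)+1
-- (structural recursion on a fuel argument; fuel n suffices for g n)

gAux : ℕ → ℕ → ℕ
gAux zero    n = 0
gAux (suc k) n = 4 * gAux k (n / 2) + n % 2

g : ℕ → ℕ
g n = gAux n n

bracketExp : ℕ → ℕ → ℕ
bracketExp a b = 1 + 2 * g a + 4 * g b

φr : ℕ → ℕ
φr 1  = 1
φr 3  = 3
φr 5  = 7
φr 9  = 9
φr 7  = 21
φr 11 = 27
φr 13 = 23
φr 15 = 29
φr _  = 0   -- even residues: never used (φ is only applied to odd powers)

φExp : ℕ → ℕ
φExp n = 40 * (n / 16) + φr (n % 16)

angleExp : ℕ → ℕ → ℕ
angleExp a b = φExp (bracketExp a b)

-- Since (a,b) ↦ [a,b] is a bijection from ℕ×ℕ onto the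
-- odd-degree monomials t^n, an element of V = t ℤ/2[t²] is exactly a
-- (ℤ/2-)sum of brackets [c,d]; we present it by a list of such pairs.

VElt : Set
VElt = List (ℕ × ℕ)

⟦_⟧ : VElt → Poly
⟦ ps ⟧ = map (λ { (c , d) → bracketExp c d }) ps

InV₁ : VElt → Set
InV₁ f = ∀ n → coeff ⟦ f ⟧ n ≡ true → n % 4 ≡ 1

s : ℕ → ℕ → VElt → Poly
s i j ps = map (λ { (c , d) → angleExp (2 * c + i) (2 * d + j) }) ps

-- w^(-e) f(w^10): every exponent n of f is ≥ 1, so 10 n - e (e ≤ 9)
-- is an honest (untruncated) natural-number subtraction here.
shiftSubst : ℕ → Poly → Poly
shiftSubst e f = map (λ n → 10 * n ∸ e) f

-- Write [a,b] = t^(1 + 2 ι(a,b)), where ι(a,b) = g(a) + 2 g(b) interleaves the binary digits of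
-- a and b.  So (a,b) ↦ [a,b] is injective: the pairs of a presentation of f that do not cancel
-- are exactly the monomials of f, and it suffices to compare both sides on those.  A monomial
-- [c,d] of V₁ has c = 2c′ even, and then for i < 4, j < 2 the digits give
-- ι(2c+i, 2d+j) = ι(i,j) + 8 ι(c′,d).  As φ(t^16 f) = w^40 φ(f), this yields
-- w^10 ⟨2c+i, 2d+j⟩ = ⟨i,j⟩ [c,d](w^10), and ⟨i,j⟩ = w, w^3, w^7, w^9 in the four cases.
module Submission where

open import Defs
open import Data.Bool using (true; false; not; T)
open import Data.Bool.Properties using (not-involutive)
open import Data.Empty using (⊥-elim)
open import Data.List using (List; []; _∷_; map; _++_; length)
open import Data.List.Properties using (map-∘)
open import Data.List.Membership.Propositional using (_∈_)
open import Data.List.Membership.Propositional.Properties using (∈-map⁻; ∈-∃++)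
open import Data.List.Relation.Unary.Any using (here; there)
open import Data.List.Relation.Binary.Permutation.Propositional as ↭ using (_↭_)
open import Data.List.Relation.Binary.Permutation.Propositional.Properties using (shift; map⁺; ↭-length)
open import Data.Nat using (ℕ; zero; suc; _+_; _*_; _∸_; _≡ᵇ_; _≤_; _<_; s≤s; z≤n; z<s; s<s; NonZero)
open import Data.Nat.DivMod
open import Data.Nat.Divisibility using (divides-refl)
open import Data.Nat.Properties
open import Data.Nat.Tactic.RingSolver using (solve-∀)
open import Data.Product using (_×_; _,_; ∃)
open import Function.Definitions using (Injective)
open import Relation.Binary.PropositionalEquality

≡ᵇ-true⇒≡ : ∀ {m n} → (m ≡ᵇ n) ≡ true → m ≡ n
≡ᵇ-true⇒≡ {m} {n} eq = ≡ᵇ⇒≡ m n (subst T (sym eq) _)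

≡ᵇ-refl : ∀ n → (n ≡ᵇ n) ≡ true
≡ᵇ-refl zero    = refl
≡ᵇ-refl (suc n) = ≡ᵇ-refl n

coeff-∷-≡ : ∀ n p → coeff (n ∷ p) n ≡ not (coeff p n)
coeff-∷-≡ n p rewrite ≡ᵇ-refl n = refl

coeff-∷-≢ : ∀ {m n} p → m ≢ n → coeff (m ∷ p) n ≡ coeff p n
coeff-∷-≢ {m} {n} p m≢n with m ≡ᵇ n in eq
... | true  = ⊥-elim (m≢n (≡ᵇ-true⇒≡ eq))
... | false = refl

coeff≡true⇒∈ : ∀ p {n} → coeff p n ≡ true → n ∈ p
coeff≡true⇒∈ (m ∷ p) {n} c with m ≡ᵇ n in eq
... | true  = here (sym (≡ᵇ-true⇒≡ eq))
... | false = there (coeff≡true⇒∈ p c)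

∷-cong : ∀ x {p q} → p ≈ q → x ∷ p ≈ x ∷ q
∷-cong x p≈q k rewrite p≈q k = refl

∷-comm : ∀ x y p → x ∷ y ∷ p ≈ y ∷ x ∷ p
∷-comm x y p k with x ≡ᵇ k | y ≡ᵇ k
... | true  | true  = refl
... | true  | false = refl
... | false | true  = refl
... | false | false = refl

∷-∷-cancel : ∀ x p → x ∷ x ∷ p ≈ p
∷-∷-cancel x p k with x ≡ᵇ k
... | true  = not-involutive (coeff p k)
... | false = refl

↭⇒≈ : ∀ {p q} → p ↭ q → p ≈ q
↭⇒≈ ↭.refl                  k = refl
↭⇒≈ (↭.prep {p} {q} x p↭q)   = ∷-cong x {p} {q} (↭⇒≈ p↭q)
↭⇒≈ (↭.swap {p} {q} x y p↭q) k =
  trans (∷-comm x y p k) (∷-cong y {x ∷ p} {x ∷ q} (∷-cong x {p} {q} (↭⇒≈ p↭q)) k)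
↭⇒≈ (↭.trans p↭q q↭r)       k = trans (↭⇒≈ p↭q k) (↭⇒≈ q↭r k)

OddIn : {A : Set} → (A → ℕ) → List A → A → Set
OddIn key xs x = coeff (map key xs) (key x) ≡ true

module _ {A : Set} (key : A → ℕ) (key-injective : Injective _≡_ _≡_ key) where

  cancel-pair : ∀ x xs → OddIn key xs x →
    ∃ λ ys → suc (length ys) ≡ length xs × (∀ (h : A → ℕ) → map h (x ∷ xs) ≈ map h ys)
  cancel-pair x xs odd
    with y , y∈xs , kx≡ky ← ∈-map⁻ key (coeff≡true⇒∈ (map key xs) odd)
    with refl ← key-injective kx≡ky
    with pre , post , refl ← ∈-∃++ y∈xs
    = pre ++ post , sym (↭-length (shift x pre post)) , λ h k →
        trans (↭⇒≈ (map⁺ h (↭.prep x (shift x pre post))) k) (∷-∷-cancel (h x) (map h (pre ++ post)) k)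

  map-cong-odd : ∀ (F G : A → ℕ) xs → (∀ x → OddIn key xs x → F x ≡ G x) → map F xs ≈ map G xs
  map-cong-odd F G xs = go (length xs) xs ≤-refl
    where
    go : ∀ m xs → length xs ≤ m → (∀ x → OddIn key xs x → F x ≡ G x) → map F xs ≈ map G xs
    go _       []       _   _     k = refl
    go (suc m) (x ∷ xs) (s≤s len≤m) agree with coeff (map key xs) (key x) in x-in-xs
    ... | false rewrite agree x (trans (coeff-∷-≡ (key x) (map key xs)) (cong not x-in-xs)) =
      ∷-cong (G x) {map F xs} {map G xs} (go m xs len≤m agree-xs)
      where
      agree-xs : ∀ z → OddIn key xs z → F z ≡ G z
      agree-xs z z-odd = agree z (trans (coeff-∷-≢ (map key xs) kx≢kz) z-odd)
        where
        kx≢kz : key x ≢ key z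
        kx≢kz kx≡kz with () ← trans (sym x-in-xs) (trans (cong (coeff (map key xs)) kx≡kz) z-odd)
    ... | true with ys , len , cancel ← cancel-pair x xs x-in-xs = λ k →
      trans (cancel F k) (trans (go m ys ys≤m agree-ys k) (sym (cancel G k)))
      where
      ys≤m : length ys ≤ m
      ys≤m = ≤-trans (n≤1+n _) (≤-trans (≤-reflexive len) len≤m)
      agree-ys : ∀ z → OddIn key ys z → F z ≡ G z
      agree-ys z z-odd = agree z (trans (cancel key (key z)) z-odd)

[r+qn]%n≡r : ∀ {r n} q .{{_ : NonZero n}} → r < n → (r + q * n) % n ≡ r
[r+qn]%n≡r {r} {n} q r<n = trans ([m+kn]%n≡m%n r q n) (m<n⇒m%n≡m r<n)

[r+qn]/n≡q : ∀ {r n} q .{{_ : NonZero n}} → r < n → (r + q * n) / n ≡ q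
[r+qn]/n≡q {r} {n} q r<n = begin
  (r + q * n) / n    ≡⟨ +-distrib-/-∣ʳ r (divides-refl q) ⟩
  r / n + q * n / n  ≡⟨ cong₂ _+_ (m<n⇒m/n≡0 r<n) (m*n/n≡m q n) ⟩
  q                  ∎
  where open ≡-Reasoning

divMod-unique : ∀ {r r′ q q′ n} .{{_ : NonZero n}} → r < n → r′ < n →
  r + q * n ≡ r′ + q′ * n → r ≡ r′ × q ≡ q′
divMod-unique {q = q} {q′} {n} r<n r′<n eq =
  trans (sym ([r+qn]%n≡r q r<n)) (trans (cong (_% n) eq) ([r+qn]%n≡r q′ r′<n)) ,
  trans (sym ([r+qn]/n≡q q r<n)) (trans (cong (_/ n) eq) ([r+qn]/n≡q q′ r′<n))

n≤1+k⇒n/2≤k : ∀ {n k} → n ≤ suc k → n / 2 ≤ k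
n≤1+k⇒n/2≤k {zero}  _     = z≤n
n≤1+k⇒n/2≤k {suc n} n≤1+k = ≤-pred (≤-trans (m/n<m (suc n) 2 (s<s z<s)) n≤1+k)

gAux-0 : ∀ k → gAux k 0 ≡ 0
gAux-0 zero    = refl
gAux-0 (suc k) rewrite gAux-0 k = refl

gAux-fuel : ∀ {k k′ n} → n ≤ k → n ≤ k′ → gAux k n ≡ gAux k′ n
gAux-fuel {zero}  {k′}     z≤n _   = sym (gAux-0 k′)
gAux-fuel {suc k} {zero}   _   z≤n = gAux-0 (suc k)
gAux-fuel {suc k} {suc k′} {n} n≤k n≤k′ =
  cong (λ v → 4 * v + n % 2) (gAux-fuel (n≤1+k⇒n/2≤k n≤k) (n≤1+k⇒n/2≤k n≤k′))

g-unfold : ∀ n → g n ≡ 4 * g (n / 2) + n % 2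
g-unfold zero    = refl
g-unfold (suc k) = cong (λ v → 4 * v + suc k % 2) (gAux-fuel (n≤1+k⇒n/2≤k {k = k} ≤-refl) ≤-refl)

g-2n+i : ∀ n {i} → i < 2 → g (2 * n + i) ≡ 4 * g n + i
g-2n+i n {i} i<2 = begin
  g (2 * n + i)                                  ≡⟨ cong g 2n+i≡i+n*2 ⟩
  g (i + n * 2)                                  ≡⟨ g-unfold (i + n * 2) ⟩
  4 * g ((i + n * 2) / 2) + (i + n * 2) % 2      ≡⟨ cong₂ (λ q r → 4 * g q + r) ([r+qn]/n≡q n i<2) ([r+qn]%n≡r n i<2) ⟩
  4 * g n + i                                    ∎
  where
  open ≡-Reasoning
  2n+i≡i+n*2 : 2 * n + i ≡ i + n * 2
  2n+i≡i+n*2 = trans (+-comm (2 * n) i) (cong (i +_) (*-comm 2 n))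

g-4n+2b+a : ∀ n {a b} → a < 2 → b < 2 → g (4 * n + (2 * b + a)) ≡ 16 * g n + g (2 * b + a)
g-4n+2b+a n {a} {b} a<2 b<2 = begin
  g (4 * n + (2 * b + a))      ≡⟨ cong g (regroup n b a) ⟩
  g (2 * (2 * n + b) + a)      ≡⟨ g-2n+i (2 * n + b) a<2 ⟩
  4 * g (2 * n + b) + a        ≡⟨ cong (λ v → 4 * v + a) (g-2n+i n b<2) ⟩
  4 * (4 * g n + b) + a        ≡⟨ expand (g n) b a ⟩
  16 * g n + (4 * b + a)       ≡⟨ cong (λ v → 16 * g n + (4 * v + a)) (g-2n+i 0 b<2) ⟨
  16 * g n + (4 * g b + a)     ≡⟨ cong (16 * g n +_) (g-2n+i b a<2) ⟨
  16 * g n + g (2 * b + a)     ∎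
  where
  open ≡-Reasoning
  regroup : ∀ n b a → 4 * n + (2 * b + a) ≡ 2 * (2 * n + b) + a
  regroup = solve-∀
  expand : ∀ x b a → 4 * (4 * x + b) + a ≡ 16 * x + (4 * b + a)
  expand = solve-∀

g-4n+i : ∀ n {i} → i < 4 → g (4 * n + i) ≡ 16 * g n + g i
g-4n+i n {0} _ = g-4n+2b+a n {0} {0} z<s z<s
g-4n+i n {1} _ = g-4n+2b+a n {1} {0} (s<s z<s) z<s
g-4n+i n {2} _ = g-4n+2b+a n {0} {1} z<s (s<s z<s)
g-4n+i n {3} _ = g-4n+2b+a n {1} {1} (s<s z<s) (s<s z<s)
g-4n+i n {suc (suc (suc (suc _)))} (s<s (s<s (s<s (s<s ()))))

interleave : ℕ → ℕ → ℕ
interleave a b = g a + 2 * g b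

bracketExp≡1+2*interleave : ∀ a b → bracketExp a b ≡ 1 + 2 * interleave a b
bracketExp≡1+2*interleave a b = regroup (g a) (g b)
  where
  regroup : ∀ x y → 1 + 2 * x + 4 * y ≡ 1 + 2 * (x + 2 * y)
  regroup = solve-∀

interleave-unfold : ∀ a b → interleave a b ≡ (a % 2 + b % 2 * 2) + interleave (a / 2) (b / 2) * 4
interleave-unfold a b = trans (cong₂ (λ x y → x + 2 * y) (g-unfold a) (g-unfold b))
  (regroup (g (a / 2)) (a % 2) (g (b / 2)) (b % 2))
  where
  regroup : ∀ x r y q → 4 * x + r + 2 * (4 * y + q) ≡ (r + q * 2) + (x + 2 * y) * 4
  regroup = solve-∀

two-bits<4 : ∀ {i j} → i < 2 → j < 2 → i + j * 2 < 4
two-bits<4 {i} {j} i<2 j<2 = +-mono-<-≤ i<2 (*-monoˡ-≤ 2 (≤-pred j<2))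

divMod-injective : ∀ {m n d} .{{_ : NonZero d}} → m % d ≡ n % d → m / d ≡ n / d → m ≡ n
divMod-injective {m} {n} {d} %≡ /≡ =
  trans (m≡m%n+[m/n]*n m d) (trans (cong₂ (λ r q → r + q * d) %≡ /≡) (sym (m≡m%n+[m/n]*n n d)))

interleave-injective : ∀ {a b a′ b′} → interleave a b ≡ interleave a′ b′ → a ≡ a′ × b ≡ b′
interleave-injective {a} {b} {a′} {b′} = go (a + b + a′ + b′) a≤ b≤ a′≤ b′≤
  where
  a≤ : a ≤ a + b + a′ + b′
  a≤ = ≤-trans (m≤m+n a b) (≤-trans (m≤m+n (a + b) a′) (m≤m+n _ b′))
  b≤ : b ≤ a + b + a′ + b′
  b≤ = ≤-trans (m≤n+m b a) (≤-trans (m≤m+n (a + b) a′) (m≤m+n _ b′))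
  a′≤ : a′ ≤ a + b + a′ + b′
  a′≤ = ≤-trans (m≤n+m a′ (a + b)) (m≤m+n _ b′)
  b′≤ : b′ ≤ a + b + a′ + b′
  b′≤ = m≤n+m b′ (a + b + a′)

  bits<4 : ∀ m n → m % 2 + n % 2 * 2 < 4
  bits<4 m n = two-bits<4 (m%n<n m 2) (m%n<n n 2)

  go : ∀ k {a b a′ b′} → a ≤ k → b ≤ k → a′ ≤ k → b′ ≤ k →
    interleave a b ≡ interleave a′ b′ → a ≡ a′ × b ≡ b′
  go zero z≤n z≤n z≤n z≤n _ = refl , refl
  go (suc k) {a} {b} {a′} {b′} a≤ b≤ a′≤ b′≤ eq
    with low≡ , high≡ ← divMod-unique (bits<4 a b) (bits<4 a′ b′)
                          (trans (sym (interleave-unfold a b)) (trans eq (interleave-unfold a′ b′)))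
    with a%≡ , b%≡ ← divMod-unique (m%n<n a 2) (m%n<n a′ 2) low≡
    with a/≡ , b/≡ ← go k (n≤1+k⇒n/2≤k a≤) (n≤1+k⇒n/2≤k b≤) (n≤1+k⇒n/2≤k a′≤) (n≤1+k⇒n/2≤k b′≤) high≡
    = divMod-injective a%≡ a/≡ , divMod-injective b%≡ b/≡

bracket : ℕ × ℕ → ℕ
bracket (a , b) = bracketExp a b

bracket-injective : Injective _≡_ _≡_ bracket
bracket-injective {a , b} {a′ , b′} eq
  with refl , refl ← interleave-injective {a} {b} {a′} {b′} (*-cancelˡ-≡ _ _ 2 (suc-injective
         (trans (sym (bracketExp≡1+2*interleave a b)) (trans eq (bracketExp≡1+2*interleave a′ b′)))))
  = refl

bracketExp%4≡1⇒even : ∀ c d → bracketExp c d % 4 ≡ 1 → ∃ λ c′ → c ≡ 2 * c′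
bracketExp%4≡1⇒even c d ≡1 = c / 2 , (begin
    c                    ≡⟨ m≡m%n+[m/n]*n c 2 ⟩
    c % 2 + c / 2 * 2    ≡⟨ cong (_+ c / 2 * 2) c%2≡0 ⟩
    c / 2 * 2            ≡⟨ *-comm (c / 2) 2 ⟩
    2 * (c / 2)          ∎)
  where
  open ≡-Reasoning
  regroup : ∀ x r y → 1 + 2 * (4 * x + r) + 4 * y ≡ (1 + r * 2) + (2 * x + y) * 4
  regroup = solve-∀
  low-digit : 1 + c % 2 * 2 ≡ 1
  low-digit = begin
    1 + c % 2 * 2                                         ≡⟨ [r+qn]%n≡r (2 * g (c / 2) + g d) (two-bits<4 (s<s z<s) (m%n<n c 2)) ⟨
    ((1 + c % 2 * 2) + (2 * g (c / 2) + g d) * 4) % 4    ≡⟨ cong (_% 4) (regroup (g (c / 2)) (c % 2) (g d)) ⟨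
    (1 + 2 * (4 * g (c / 2) + c % 2) + 4 * g d) % 4      ≡⟨ cong (λ x → (1 + 2 * x + 4 * g d) % 4) (g-unfold c) ⟨
    bracketExp c d % 4                                    ≡⟨ ≡1 ⟩
    1                                                     ∎
  c%2≡0 : c % 2 ≡ 0
  c%2≡0 = *-cancelʳ-≡ _ 0 2 (suc-injective low-digit)

φExp-+16* : ∀ n q → φExp (n + q * 16) ≡ φExp n + 40 * q
φExp-+16* n q = begin
  40 * ((n + q * 16) / 16) + φr ((n + q * 16) % 16)  ≡⟨ cong₂ (λ x y → 40 * x + φr y) quotient ([m+kn]%n≡m%n n q 16) ⟩
  40 * (n / 16 + q) + φr (n % 16)                     ≡⟨ regroup (n / 16) q (φr (n % 16)) ⟩
  40 * (n / 16) + φr (n % 16) + 40 * q                ∎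
  where
  open ≡-Reasoning
  quotient : (n + q * 16) / 16 ≡ n / 16 + q
  quotient = trans (+-distrib-/-∣ʳ n (divides-refl q)) (cong (n / 16 +_) (m*n/n≡m q 16))
  regroup : ∀ x q r → 40 * (x + q) + r ≡ 40 * x + r + 40 * q
  regroup = solve-∀

angleExp-substitution : ∀ c d {i j} → i < 4 → j < 2 →
  angleExp (2 * (2 * c) + i) (2 * d + j) + 10 ≡ angleExp i j + 10 * bracketExp (2 * c) d
angleExp-substitution c d {i} {j} i<4 j<2 = begin
  φExp (bracketExp (2 * (2 * c) + i) (2 * d + j)) + 10   ≡⟨ cong (λ n → φExp n + 10) bracket-shifted ⟩
  φExp (bracketExp i j + N * 16) + 10                    ≡⟨ cong (_+ 10) (φExp-+16* (bracketExp i j) N) ⟩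
  angleExp i j + 40 * N + 10                             ≡⟨ regroup (angleExp i j) (g c) (g d) ⟩
  angleExp i j + 10 * (1 + 2 * (4 * g c) + 4 * g d)      ≡⟨ cong (λ x → angleExp i j + 10 * (1 + 2 * x + 4 * g d)) g-2c ⟨
  angleExp i j + 10 * bracketExp (2 * c) d               ∎
  where
  open ≡-Reasoning
  N : ℕ
  N = 2 * g c + g d
  g-2c : g (2 * c) ≡ 4 * g c
  g-2c = trans (cong g (sym (+-identityʳ (2 * c)))) (trans (g-2n+i c z<s) (+-identityʳ _))
  expand : ∀ x y r s → 1 + 2 * (16 * x + r) + 4 * (4 * y + s) ≡ (1 + 2 * r + 4 * s) + (2 * x + y) * 16
  expand = solve-∀
  regroup : ∀ a x y → a + 40 * (2 * x + y) + 10 ≡ a + 10 * (1 + 2 * (4 * x) + 4 * y)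
  regroup = solve-∀
  bracket-shifted : bracketExp (2 * (2 * c) + i) (2 * d + j) ≡ bracketExp i j + N * 16
  bracket-shifted = begin
    1 + 2 * g (2 * (2 * c) + i) + 4 * g (2 * d + j)   ≡⟨ cong₂ (λ x y → 1 + 2 * g x + 4 * y) (cong (_+ i) (sym (*-assoc 2 2 c))) (g-2n+i d j<2) ⟩
    1 + 2 * g (4 * c + i) + 4 * (4 * g d + j)         ≡⟨ cong₂ (λ x y → 1 + 2 * x + 4 * (4 * g d + y)) (g-4n+i c i<4) (sym (g-2n+i 0 j<2)) ⟩
    1 + 2 * (16 * g c + g i) + 4 * (4 * g d + g j)    ≡⟨ expand (g c) (g d) (g i) (g j) ⟩
    bracketExp i j + N * 16                           ∎

x+10≡a+y⇒x≡y∸e : ∀ {x y a e} → x + 10 ≡ a + y → e + a ≡ 10 → x ≡ y ∸ e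
x+10≡a+y⇒x≡y∸e {x} {y} {a} {e} x+10≡a+y e+a≡10 = begin
  x              ≡⟨ m+n∸n≡m x e ⟨
  x + e ∸ e      ≡⟨ cong (_∸ e) (+-cancelʳ-≡ a (x + e) y x+e+a≡y+a) ⟩
  y ∸ e          ∎
  where
  open ≡-Reasoning
  x+e+a≡y+a : x + e + a ≡ y + a
  x+e+a≡y+a = begin
    x + e + a    ≡⟨ +-assoc x e a ⟩
    x + (e + a)  ≡⟨ cong (x +_) e+a≡10 ⟩
    x + 10       ≡⟨ x+10≡a+y ⟩
    a + y        ≡⟨ +-comm a y ⟩
    y + a        ∎

-- For the other four pairs (i,j) the exponent ⟨i,j⟩ exceeds 10, so the shift is by a positive
-- power of w and no e fits.
s≈shiftSubst : ∀ i j e → i < 4 → j < 2 → e + angleExp i j ≡ 10 →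
  ∀ f → InV₁ f → s i j f ≈ shiftSubst e ⟦ f ⟧
s≈shiftSubst i j e i<4 j<2 e+⟨i,j⟩≡10 f f∈V₁ k =
  trans (map-cong-odd bracket bracket-injective F G f agree k) (cong (λ p → coeff p k) (map-∘ f))
  where
  F G : ℕ × ℕ → ℕ
  F (c , d) = angleExp (2 * c + i) (2 * d + j)
  G x = 10 * bracket x ∸ e
  agree : ∀ x → OddIn bracket f x → F x ≡ G x
  agree (c , d) odd with c′ , refl ← bracketExp%4≡1⇒even c d (f∈V₁ _ odd) =
    x+10≡a+y⇒x≡y∸e {a = angleExp i j} {e} (angleExp-substitution c′ d i<4 j<2) e+⟨i,j⟩≡10

lemma6p5 : (f : VElt) → InV₁ f →
    (s 0 0 f ≈ shiftSubst 9 ⟦ f ⟧) × (s 1 0 f ≈ shiftSubst 7 ⟦ f ⟧)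
      × (s 0 1 f ≈ shiftSubst 3 ⟦ f ⟧) × (s 2 0 f ≈ shiftSubst 1 ⟦ f ⟧)
lemma6p5 f f∈V₁ =
  s≈shiftSubst 0 0 9 z<s       z<s       refl f f∈V₁ ,
  s≈shiftSubst 1 0 7 (s<s z<s) z<s       refl f f∈V₁ ,
  s≈shiftSubst 0 1 3 z<s       (s<s z<s) refl f f∈V₁ ,
  s≈shiftSubst 2 0 1 (s<s (s<s z<s)) z<s refl f f∈V₁
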